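{- For every graph $G$ of order greater than $1$, we have $\textnormal{ftadim}(G) \le \textnormal{adim}(G)+2^{\textnormal{adim}(G)}$.
   Context: Graphs are finite, simple, undirected, possibly disconnected; $\textnormal{dist}(u,v)=\infty$ between different components. A set $S=\{v_1,\dots,v_k\}$ of vertices is an adjacency resolving set of $G$ if the vectors $(\min(2,\textnormal{dist}(u,v_1)),\dots,\min(2,\textnormal{dist}(u,v_k)))$ are pairwise distinct over $u\in V(G)$. The adjacency dimension $\textnormal{adim}(G)$ is the minimum size of an adjacency resolving set. The fault-tolerant adjacency dimension $\textnormal{ftadim}(G)$ is the minimum size of a nonempty $S\subseteq V(G)$ such that $S-\{s\}$ is an adjacency resolving set for every $s\in S$. -}

module Defs where

open import Data.Nat using (ℕ; zero; suc; _≤_)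
open import Data.Bool using (Bool; true; false)
open import Data.Fin using (Fin; _≟_)
open import Data.Fin.Subset using (Subset; _∈_; _-_; ∣_∣; Nonempty)
open import Data.Product using (Σ; _×_)
open import Relation.Nullary using (¬_; yes; no)
open import Relation.Binary.PropositionalEquality using (_≡_)

-- A finite simple undirected graph on the vertex set Fin n
-- (possibly disconnected): a symmetric irreflexive adjacency relation.
record Graph (n : ℕ) : Set where
  field
    adj   : Fin n → Fin n → Bool
    sym   : ∀ u v → adj u v ≡ adj v u
    irrefl : ∀ u → adj u u ≡ false

open Graph public

-- min(2, dist(u,v)) : 0 if u = v, 1 if u,v adjacent, 2 otherwise
-- (distance ≥ 2, including ∞ between different components).
adist : ∀ {n} → Graph n → Fin n → Fin n → ℕ
adist G u v with u ≟ v
... | yes _ = 0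
... | no _ with adj G u v
...   | true  = 1
...   | false = 2

IsAdjResolving : ∀ {n} → Graph n → Subset n → Set
IsAdjResolving {n} G S =
  ∀ (u v : Fin n) → (∀ s → s ∈ S → adist G u s ≡ adist G v s) → u ≡ v

IsAdim : ∀ {n} → Graph n → ℕ → Set
IsAdim {n} G k =
  Σ (Subset n) (λ S → IsAdjResolving G S × ∣ S ∣ ≡ k)
  × (∀ (S : Subset n) → IsAdjResolving G S → k ≤ ∣ S ∣)

IsFTAdjResolving : ∀ {n} → Graph n → Subset n → Set
IsFTAdjResolving G S =
  Nonempty S × (∀ s → s ∈ S → IsAdjResolving G (S - s))

-- If S is an adjacency resolving set with |S| = k, a vertex outside S has every truncated
-- distance to S equal to 1 or 2, and these {1,2}-vectors are pairwise distinct; so at most 2^k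
-- vertices lie outside S, and the order n is at most k + 2^k.  The whole vertex set V is
-- fault-tolerant: after deleting s, each remaining vertex is recognised by its distance 0 to
-- itself, and s is the only vertex at distance 0 from none of them.  Hence
-- ftadim(G) ≤ n ≤ k + 2^k.
module Submission where

open import Defs hiding (sym)
open import Data.Nat using (ℕ; zero; suc; _≤_; _+_; _^_; z≤n)
open import Data.Nat.Properties
  using (≤-refl; ≤-reflexive; ≤-pred; ≤-trans; <-≤-trans; +-suc; +-mono-≤; +-identityʳ; m^n>0; m+[n∸m]≡n
        ; module ≤-Reasoning)
open import Data.Bool using (true; false; if_then_else_)
open import Data.Fin using (Fin; zero; _≟_)
open import Data.Fin.Subset using (Subset; ∣_∣; _∈_; _∉_; _⊆_; _∩_; ∁; _-_; ⊤; ⁅_⁆)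
open import Data.Fin.Subset.Properties
  using ( ∈⊤; ∣⊤∣≡n; ∣⊥∣≡0; ∣⁅x⁆∣≡1; ∣∁p∣≡n∸∣p∣; ∣p∣≤n; p⊆q⇒∣p∣≤∣q∣; nonempty?; Empty-unique
        ; x∈⁅x⁆; x∈p∩q⁻; p∩q⊆p; x∈∁p⇒x∉p; p─q⊆p; x∈p∧x≢y⇒x∈p-y; x∈p⇒∣p-x∣<∣p∣)
open import Data.Vec using ([]; _∷_; tabulate)
open import Data.Vec.Properties using ([]=⇒lookup; lookup⇒[]=; lookup∘tabulate)
open import Data.Product using (Σ; _×_; _,_; proj₂)
open import Relation.Nullary using (yes; no; contradiction)
open import Relation.Binary.PropositionalEquality
  using (_≡_; _≢_; refl; sym; trans; cong)

∣p∣≡∣p∩q∣+∣p∩∁q∣ : ∀ {n} (p q : Subset n) → ∣ p ∣ ≡ ∣ p ∩ q ∣ + ∣ p ∩ ∁ q ∣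
∣p∣≡∣p∩q∣+∣p∩∁q∣ []          []          = refl
∣p∣≡∣p∩q∣+∣p∩∁q∣ (true ∷ p)  (true ∷ q)  = cong suc (∣p∣≡∣p∩q∣+∣p∩∁q∣ p q)
∣p∣≡∣p∩q∣+∣p∩∁q∣ (true ∷ p)  (false ∷ q) = trans (cong suc (∣p∣≡∣p∩q∣+∣p∩∁q∣ p q)) (sym (+-suc _ _))
∣p∣≡∣p∩q∣+∣p∩∁q∣ (false ∷ p) (_ ∷ q)     = ∣p∣≡∣p∩q∣+∣p∩∁q∣ p q

n≡∣p∣+∣∁p∣ : ∀ {n} (p : Subset n) → n ≡ ∣ p ∣ + ∣ ∁ p ∣
n≡∣p∣+∣∁p∣ p = trans (sym (m+[n∸m]≡n (∣p∣≤n p))) (cong (∣ p ∣ +_) (sym (∣∁p∣≡n∸∣p∣ p)))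

subsingleton⇒∣p∣≤1 : ∀ {n} (p : Subset n) → (∀ {x y} → x ∈ p → y ∈ p → x ≡ y) → ∣ p ∣ ≤ 1
subsingleton⇒∣p∣≤1 {n} p unique with nonempty? p
... | yes (x , x∈p) = ≤-trans (p⊆q⇒∣p∣≤∣q∣ p⊆⁅x⁆) (≤-reflexive (∣⁅x⁆∣≡1 x))
  where
    p⊆⁅x⁆ : p ⊆ ⁅ x ⁆
    p⊆⁅x⁆ y∈p rewrite unique y∈p x∈p = x∈⁅x⁆ x
... | no empty = ≤-trans (≤-reflexive (trans (cong ∣_∣ (Empty-unique empty)) (∣⊥∣≡0 n))) z≤n

module _ {n : ℕ} (G : Graph n) where

  adist-self : ∀ u → adist G u u ≡ 0
  adist-self u with u ≟ u
  ... | yes _ = refl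
  ... | no u≢u = contradiction refl u≢u

  adist≡0⇒≡ : ∀ u v → adist G u v ≡ 0 → u ≡ v
  adist≡0⇒≡ u v d≡0 with u ≟ v
  ... | yes u≡v = u≡v
  ... | no _ with adj G u v
  adist≡0⇒≡ u v () | no _ | true
  adist≡0⇒≡ u v () | no _ | false

  adist-≢ : ∀ u v → u ≢ v → adist G u v ≡ (if adj G u v then 1 else 2)
  adist-≢ u v u≢v with u ≟ v
  ... | yes u≡v = contradiction u≡v u≢v
  ... | no _ with adj G u v
  ...   | true  = refl
  ...   | false = refl

  adist-cong-adj : ∀ {u v} t → u ≢ t → v ≢ t → adj G u t ≡ adj G v t → adist G u t ≡ adist G v t
  adist-cong-adj {u} {v} t u≢t v≢t same =
    trans (adist-≢ u t u≢t) (trans (cong (if_then 1 else 2) same) (sym (adist-≢ v t v≢t)))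

  neighbourhood : Fin n → Subset n
  neighbourhood t = tabulate (λ u → adj G u t)

  ∈-neighbourhood : ∀ {u} t → u ∈ neighbourhood t → adj G u t ≡ true
  ∈-neighbourhood {u} t u∈N = trans (sym (lookup∘tabulate (λ w → adj G w t) u)) ([]=⇒lookup u∈N)

  ∉-neighbourhood : ∀ {u} t → u ∉ neighbourhood t → adj G u t ≡ false
  ∉-neighbourhood {u} t u∉N with adj G u t in eq
  ... | true  = contradiction
                  (lookup⇒[]= u (neighbourhood t) (trans (lookup∘tabulate (λ w → adj G w t) u) eq))
                  u∉N
  ... | false = refl

  Separates : Subset n → Subset n → Set
  Separates T W = ∀ u v → u ∈ W → v ∈ W → (∀ s → s ∈ T → adist G u s ≡ adist G v s) → u ≡ v

  IsAdjResolving⇒Separates : ∀ {S} → IsAdjResolving G S → ∀ W → Separates S W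
  IsAdjResolving⇒Separates resolving W u v _ _ = resolving u v

  Separates-remove : ∀ {T W W′} t → Separates T W → W′ ⊆ W →
    (∀ {u v} → u ∈ W′ → v ∈ W′ → adist G u t ≡ adist G v t) → Separates (T - t) W′
  Separates-remove {T} t separates W′⊆W uniform u v u∈W′ v∈W′ agree =
    separates u v (W′⊆W u∈W′) (W′⊆W v∈W′) agree-on-T
    where
      agree-on-T : ∀ s → s ∈ T → adist G u s ≡ adist G v s
      agree-on-T s s∈T with s ≟ t
      ... | yes refl = uniform u∈W′ v∈W′
      ... | no s≢t   = agree s (x∈p∧x≢y⇒x∈p-y s∈T s≢t)

  Separates⇒∣W∣≤2^m : ∀ m T W → ∣ T ∣ ≤ m → (∀ {u} → u ∈ W → u ∉ T) → Separates T W → ∣ W ∣ ≤ 2 ^ m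
  Separates⇒∣W∣≤2^m m T W ∣T∣≤m disjoint separates with nonempty? T
  ... | no empty = ≤-trans (subsingleton⇒∣p∣≤1 W unique) (m^n>0 2 m)
    where
      unique : ∀ {u v} → u ∈ W → v ∈ W → u ≡ v
      unique u∈W v∈W = separates _ _ u∈W v∈W (λ s s∈T → contradiction (s , s∈T) empty)
  Separates⇒∣W∣≤2^m zero T W ∣T∣≤0 disjoint separates | yes (t , t∈T)
    with () ← <-≤-trans (x∈p⇒∣p-x∣<∣p∣ t∈T) ∣T∣≤0
  Separates⇒∣W∣≤2^m (suc m) T W ∣T∣≤1+m disjoint separates | yes (t , t∈T) = begin
    ∣ W ∣                                    ≡⟨ ∣p∣≡∣p∩q∣+∣p∩∁q∣ W N ⟩
    ∣ W ∩ N ∣ + ∣ W ∩ ∁ N ∣                   ≤⟨ +-mono-≤ (half N adjacent) (half (∁ N) non-adjacent) ⟩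
    2 ^ m + 2 ^ m                            ≡⟨ cong (2 ^ m +_) (sym (+-identityʳ (2 ^ m))) ⟩
    2 ^ suc m                                ∎
    where
      open ≤-Reasoning
      N : Subset n
      N = neighbourhood t

      ∣T-t∣≤m : ∣ T - t ∣ ≤ m
      ∣T-t∣≤m = ≤-pred (<-≤-trans (x∈p⇒∣p-x∣<∣p∣ t∈T) ∣T∣≤1+m)

      ≢t : ∀ {u} → u ∈ W → u ≢ t
      ≢t u∈W refl = disjoint u∈W t∈T

      half : ∀ X → (∀ {u v} → u ∈ W ∩ X → v ∈ W ∩ X → adj G u t ≡ adj G v t) → ∣ W ∩ X ∣ ≤ 2 ^ m
      half X same-adj = Separates⇒∣W∣≤2^m m (T - t) (W ∩ X) ∣T-t∣≤m
        (λ u∈W∩X u∈T-t → disjoint (p∩q⊆p W X u∈W∩X) (p─q⊆p T ⁅ t ⁆ u∈T-t))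
        (Separates-remove t separates (p∩q⊆p W X) λ u∈ v∈ →
          adist-cong-adj t (≢t (p∩q⊆p W X u∈)) (≢t (p∩q⊆p W X v∈)) (same-adj u∈ v∈))

      adjacent : ∀ {u v} → u ∈ W ∩ N → v ∈ W ∩ N → adj G u t ≡ adj G v t
      adjacent u∈ v∈ = trans (∈-neighbourhood t (proj₂ (x∈p∩q⁻ W N u∈)))
                             (sym (∈-neighbourhood t (proj₂ (x∈p∩q⁻ W N v∈))))

      non-adjacent : ∀ {u v} → u ∈ W ∩ ∁ N → v ∈ W ∩ ∁ N → adj G u t ≡ adj G v t
      non-adjacent u∈ v∈ = trans (∉-neighbourhood t (x∈∁p⇒x∉p (proj₂ (x∈p∩q⁻ W (∁ N) u∈))))
                                 (sym (∉-neighbourhood t (x∈∁p⇒x∉p (proj₂ (x∈p∩q⁻ W (∁ N) v∈)))))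

  n≤∣S∣+2^∣S∣ : ∀ {S} → IsAdjResolving G S → n ≤ ∣ S ∣ + 2 ^ ∣ S ∣
  n≤∣S∣+2^∣S∣ {S} resolving = begin
    n                      ≡⟨ n≡∣p∣+∣∁p∣ S ⟩
    ∣ S ∣ + ∣ ∁ S ∣         ≤⟨ +-mono-≤ ≤-refl ∣∁S∣≤2^∣S∣ ⟩
    ∣ S ∣ + 2 ^ ∣ S ∣       ∎
    where
      open ≤-Reasoning
      ∣∁S∣≤2^∣S∣ : ∣ ∁ S ∣ ≤ 2 ^ ∣ S ∣
      ∣∁S∣≤2^∣S∣ = Separates⇒∣W∣≤2^m ∣ S ∣ S (∁ S) ≤-refl x∈∁p⇒x∉p
                     (IsAdjResolving⇒Separates resolving (∁ S))

  ∈-resolved : ∀ {S} u v → u ∈ S → (∀ s → s ∈ S → adist G u s ≡ adist G v s) → u ≡ v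
  ∈-resolved u v u∈S agree = sym (adist≡0⇒≡ v u (trans (sym (agree u u∈S)) (adist-self u)))

  ⊤-x-isAdjResolving : ∀ x → IsAdjResolving G (⊤ - x)
  ⊤-x-isAdjResolving x u v agree with u ≟ x | v ≟ x
  ... | no u≢x | _      = ∈-resolved u v (x∈p∧x≢y⇒x∈p-y ∈⊤ u≢x) agree
  ... | yes _  | no v≢x = sym (∈-resolved v u (x∈p∧x≢y⇒x∈p-y ∈⊤ v≢x) (λ s s∈ → sym (agree s s∈)))
  ... | yes u≡x | yes v≡x = trans u≡x (sym v≡x)

theorem17 : ∀ (n : ℕ) → 2 ≤ n → (G : Graph n) → (k : ℕ) → IsAdim G k →
    Σ (Subset n) (λ S → IsFTAdjResolving G S × ∣ S ∣ ≤ k + 2 ^ k)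
theorem17 (suc n) _ G k ((S , resolving , refl) , _) =
  ⊤ , ((zero , ∈⊤) , λ x _ → ⊤-x-isAdjResolving G x) ,
  ≤-trans (≤-reflexive (∣⊤∣≡n (suc n))) (n≤∣S∣+2^∣S∣ G resolving)
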